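{- Let $(G,\pi,r)$ be an instance of $r$-Hypergraph Label Cover in which every vertex has the same degree, and let $(V,\mathcal{S},d)$ with $k$ be the Robust $k$-Median instance on the line constructed from it as described below. Suppose that, for some constant $\gamma$, every labeling weakly satisfies at most a $2^{ -\gamma r}$ fraction of the edges of $G$, and that $r^72^{ -\gamma r}<1$. Then every solution to the Robust $k$-Median instance $(V,\mathcal{S},d)$ has objective value at least $r$.
   Context: $r$-Hypergraph Label Cover: an instance $(G,\pi,r)$ consists of an $r$-partite hypergraph $G=(\mathcal{V},\mathcal{E})$ with $\mathcal{V}=\bigcup_{j=1}^r\mathcal{V}_j$, where every edge contains exactly one vertex of each $\mathcal{V}_j$; label sets $L_j=\{1,\dots,|L_j|\}$; a color set $C$; and maps $\pi_h^j:L_j\to C$ for $h\in\mathcal{E}$, $j\in[r]$. A labeling assigns $\sigma(v)\in L_j$ to each $v\in\mathcal{V}_j$; an edge $h=(v_1,\dots,v_r)$ is weakly satisfied if $\pi_h^j(\sigma(v_j))=\pi_h^{j'}(\sigma(v_{j'}))$ for some $j\ne j'$. Vertex degree is the number of edges containing the vertex. $(r,C)$-partition system: a finite set $Z$ with, for each $c\in C$, a partition $(A_c^1,\dots,A_c^r)$ of $Z$ into $r$ pairwise disjoint sets with union $Z$, such that for any pairwise distinct $c_1,\dots,c_r\in C$ and any $j_1,\dots,j_r\in[r]$, $\bigcap_{i}A_{c_i}^{j_i}\ne\emptyset$. Robust $k$-Median: given locations $V$, client sets $\mathcal{S}$ and metric $d$, choose $F\subseteq V$ with $|F|=k$ minimizing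 $\max_{S\in\mathcal{S}}\sum_{x\in S}d(x,F)$, where $d(x,F)=\min_{y\in F}d(x,y)$. Construction: for each $h\in\mathcal{E}$ take pairwise disjoint equal-size sets $U_h$, each the ground set of an $(r,C)$-partition system with partitions $(A_c^1(h),\dots,A_c^r(h))_{c\in C}$; $U=\bigcup_hU_h$. For $j\in[r]$, $v\in\mathcal{V}_j$, $\ell\in L_j$ let $X(v,\ell)=\bigcup_{h:v\in h}A^j_{\pi_h^j(\ell)}(h)$, $\mathcal{X}=\{X(v,\ell)\}$, $t=|\mathcal{V}|$. The Robust $k$-Median instance has one location for each $X(v,\ell)$ (denoted by the same symbol), $V=\mathcal{X}$; for each $e\in U$ a client set $S(e)=\{X(v,\ell)\in\mathcal{X}:e\in X(v,\ell)\}$, $\mathcal{S}=\{S(e):e\in U\}$; $k=|\mathcal{X}|-t$. The locations are placed on the real line so that for each vertex $v\in\mathcal{V}_j$ the locations $X(v,1),\dots,X(v,|L_j|)$ are consecutive with $d(X(v,\ell),X(v,\ell'))=|\ell-\ell'|$, and $d(X(v,\ell),X(v',\ell'))\ge 2$ whenever $v\ne v'$; $d$ is the induced distance on the line.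
   Formalization: The locations are placed at rational positions on the line instead of at arbitrary real positions. -}

module Defs where

open import Data.Nat as ℕ using (ℕ; zero; suc; _∸_)
open import Data.Integer using (+_)
open import Data.Fin using (Fin; toℕ; _≟_)
open import Data.Fin.Properties using (any?)
open import Data.List using (List; []; _∷_; map; concatMap; length; filter; allFin; foldr)
open import Data.Nat.ListAction using (sum)
open import Data.Product using (Σ; ∃; ∃₂; _×_; _,_)
open import Data.Bool using (Bool; true; false; if_then_else_; T)
open import Data.Bool.Properties using (T?)
open import Data.Rational as ℚ using (ℚ; ∣_∣; _-_; _+_; _⊓_; 0ℚ; _/_)
open import Relation.Nullary using (¬_; Dec; does)
open import Relation.Nullary.Decidable using (¬?; _×-dec_)
open import Relation.Binary.PropositionalEquality using (_≡_; _≢_)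
open import Function.Definitions using (Injective)

ℕ→ℚ : ℕ → ℚ
ℕ→ℚ n = + n / 1

-- Part j of the vertex set is Fin (nV j); label set L_j is Fin (nL j)
-- (label ℓ ∈ {1..|L_j|} is represented by toℕ ℓ ∈ {0..|L_j|-1});
-- colour set C is Fin nC; edges are Fin nE, edge h j is the unique
-- vertex of V_j in h.
record HLC (r : ℕ) : Set where
  field
    nV       : Fin r → ℕ
    nL       : Fin r → ℕ
    nC       : ℕ
    nE       : ℕ
    edge     : Fin nE → (j : Fin r) → Fin (nV j)
    edge-inj : ∀ h h' → (∀ j → edge h j ≡ edge h' j) → h ≡ h'
    π        : Fin nE → (j : Fin r) → Fin (nL j) → Fin nC

module _ {r : ℕ} (G : HLC r) where
  open HLC G

  Labeling : Set
  Labeling = (j : Fin r) → Fin (nV j) → Fin (nL j)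

  WeaklySatisfied : Labeling → Fin nE → Set
  WeaklySatisfied σ h =
    ∃₂ λ j j' → j ≢ j' × π h j (σ j (edge h j)) ≡ π h j' (σ j' (edge h j'))

  weaklySatisfied? : (σ : Labeling) → (h : Fin nE) → Dec (WeaklySatisfied σ h)
  weaklySatisfied? σ h =
    any? λ j → any? λ j' → ¬? (j ≟ j') ×-dec (π h j (σ j (edge h j)) ≟ π h j' (σ j' (edge h j')))

  numSatisfied : Labeling → ℕ
  numSatisfied σ = length (filter (weaklySatisfied? σ) (allFin nE))

  degree : (j : Fin r) → Fin (nV j) → ℕ
  degree j v = length (filter (λ h → edge h j ≟ v) (allFin nE))

  Regular : Set
  Regular = ∃ λ D → ∀ j v → degree j v ≡ D

-- (r,C)-partition system on ground set Z = Fin m, |C| = nC.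
-- part c z = the index j with z ∈ A_c^j; thus (A_c^1,…,A_c^r) is a
-- partition of Z into r pairwise disjoint sets with union Z.
record PartitionSystem (r nC m : ℕ) : Set where
  field
    part  : Fin nC → Fin m → Fin r
    cover : (c : Fin r → Fin nC) → Injective _≡_ _≡_ c →
            (js : Fin r → Fin r) → ∃ λ z → ∀ i → part (c i) z ≡ js i

-- Extended nonnegative values (d(x,∅) = ∞)
data ℚ∞ : Set where
  fin : ℚ → ℚ∞
  ∞   : ℚ∞

_⊓∞_ : ℚ∞ → ℚ∞ → ℚ∞
fin a ⊓∞ fin b = fin (a ⊓ b)
fin a ⊓∞ ∞     = fin a
∞     ⊓∞ y     = y

_+∞_ : ℚ∞ → ℚ∞ → ℚ∞
fin a +∞ fin b = fin (a + b)
fin a +∞ ∞     = ∞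
∞     +∞ y     = ∞

data _≤∞_ : ℚ∞ → ℚ∞ → Set where
  fin≤fin : ∀ {a b} → a ℚ.≤ b → fin a ≤∞ fin b
  x≤∞     : ∀ {x} → x ≤∞ ∞

-- The Robust k-Median instance constructed from G and the partition
-- systems ps h (ground sets U_h = {h} × Fin m, U = Fin nE × Fin m).
module Construction {r : ℕ} (G : HLC r) (m : ℕ)
                    (ps : Fin (HLC.nE G) → PartitionSystem r (HLC.nC G) m) where
  open HLC G
  open PartitionSystem

  Loc : Set
  Loc = Σ (Fin r) λ j → Fin (nV j) × Fin (nL j)

  allLocs : List Loc
  allLocs = concatMap (λ j → concatMap (λ v → map (λ ℓ → (j , v , ℓ)) (allFin (nL j)))
                                        (allFin (nV j)))
                      (allFin r)

  Elem : Set
  Elem = Fin nE × Fin m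

  _∈X_ : Elem → Loc → Set
  (h , z) ∈X (j , v , ℓ) = edge h j ≡ v × part (ps h) (π h j ℓ) z ≡ j

  _∈X?_ : (e : Elem) → (x : Loc) → Dec (e ∈X x)
  (h , z) ∈X? (j , v , ℓ) = (edge h j ≟ v) ×-dec (part (ps h) (π h j ℓ) z ≟ j)

  numLocs : ℕ
  numLocs = length allLocs

  t : ℕ
  t = sum (map nV (allFin r))

  k : ℕ
  k = numLocs ∸ t

  LinePlacement : (Loc → ℚ) → Set
  LinePlacement pos =
    (∀ j v ℓ ℓ' → ∣ pos (j , v , ℓ) - pos (j , v , ℓ') ∣ ≡ ∣ ℕ→ℚ (toℕ ℓ) - ℕ→ℚ (toℕ ℓ') ∣) ×
    (∀ j v ℓ j' v' ℓ' → _≢_ {A = Σ (Fin r) (λ i → Fin (nV i))} (j , v) (j' , v') →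
        ℕ→ℚ 2 ℚ.≤ ∣ pos (j , v , ℓ) - pos (j' , v' , ℓ') ∣)

  size : (Loc → Bool) → ℕ
  size F = length (filter (λ x → T? (F x)) allLocs)

  module _ (pos : Loc → ℚ) where
    d : Loc → Loc → ℚ
    d x y = ∣ pos x - pos y ∣

    distF : Loc → (Loc → Bool) → ℚ∞
    distF x F = foldr (λ y acc → if F y then fin (d x y) ⊓∞ acc else acc) ∞ allLocs

    clientCost : Elem → (Loc → Bool) → ℚ∞
    clientCost e F = foldr (λ x acc → if does (e ∈X? x) then distF x F +∞ acc else acc)
                           (fin 0ℚ) allLocs

    ObjectiveAtLeast : ℚ → (Loc → Bool) → Set
    ObjectiveAtLeast a F = ∃ λ (e : Elem) → fin a ≤∞ clientCost e F

module Submission where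

-- Call a location X(v, ℓ) closed when it is not in F.  As |F| = k = |𝒳| − t, exactly t locations are
-- closed, so by regularity an average edge carries exactly r closed labels on its vertices.  A client
-- S(e) pays at least 1 for each of its closed locations, an open facility being at distance at least
-- 1 from it on the line; so suppose every e ∈ U lies in fewer than r closed locations.  Then the cover
-- property of the partition system on U_h forbids a vertex of h with r closed labels, and forbids an
-- edge h with r closed labels unless two of them, on different vertices, share their colour:
-- otherwise the colour determines the part, and r greedily chosen distinct colours yield an element
-- of U_h lying in r closed locations.  At least a 1/r² fraction of the edges carry r closed labels,
-- and each of them is weakly satisfied by one of r⁴ labelings picking, at two parts, one of the fewer
-- than r closed labels of the vertex.  So some labeling satisfies a 1/r⁶ fraction of the edges,
-- which contradicts soundness as r⁷ ε < 1.

open import Defs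
open import Data.Nat using (ℕ)
open import Data.Fin using (Fin)
open import Data.Bool using (Bool)
open import Data.Rational using (ℚ)

module FiniteSums where

  open import Data.Bool using (if_then_else_)
  open import Data.Empty using (⊥-elim)
  open import Data.Fin using (zero; suc)
  import Data.Fin as Fin
  import Data.Fin.Properties as Finₚ
  open import Data.List using (List; []; _∷_; _++_; map; concatMap; length; filter; allFin; cartesianProduct)
  open import Data.List.Membership.Propositional using (_∈_)
  open import Data.List.Properties using (map-tabulate; length-++; length-map; length-tabulate)
  open import Data.List.Relation.Unary.Any using (here; there)
  open import Data.Nat
  open import Data.Nat.ListAction using (sum)
  open import Data.Nat.Properties
  open import Algebra.Properties.CommutativeSemigroup +-commutativeSemigroup using (interchange)
  open import Data.Product using (∃; _×_; _,_)
  open import Function using (id)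
  open import Relation.Nullary using (¬_; Dec; yes; no; does)
  open import Relation.Unary using (Decidable)
  open import Relation.Binary.PropositionalEquality

  ∑ : {A : Set} → List A → (A → ℕ) → ℕ
  ∑ []       f = 0
  ∑ (x ∷ xs) f = f x + ∑ xs f

  syntax ∑ xs (λ x → e) = ∑[ x ∈ xs ] e

  -- Through does, so that 𝟙 (p? ×-dec q?) computes to 0 as soon as p? is a no.
  𝟙 : {P : Set} → Dec P → ℕ
  𝟙 p? = if does p? then 1 else 0

  count : {A : Set} {P : A → Set} → Decidable P → List A → ℕ
  count P? xs = ∑[ x ∈ xs ] 𝟙 (P? x)

  module _ {P : Set} where

    𝟙-yes : (p? : Dec P) → P → 𝟙 p? ≡ 1
    𝟙-yes (yes _) _ = refl
    𝟙-yes (no ¬p) p = ⊥-elim (¬p p)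

    𝟙-no : (p? : Dec P) → ¬ P → 𝟙 p? ≡ 0
    𝟙-no (yes p) ¬p = ⊥-elim (¬p p)
    𝟙-no (no _)  _  = refl

  module _ {P Q : Set} where

    𝟙-mono : (p? : Dec P) (q? : Dec Q) → (P → Q) → 𝟙 p? ≤ 𝟙 q?
    𝟙-mono (yes p) (yes _) _   = ≤-refl
    𝟙-mono (yes p) (no ¬q) p⇒q = ⊥-elim (¬q (p⇒q p))
    𝟙-mono (no _)  _       _   = z≤n

    𝟙-< : (p? : Dec P) (q? : Dec Q) → ¬ P → Q → 𝟙 p? < 𝟙 q?
    𝟙-< p? q? ¬p q rewrite 𝟙-no p? ¬p | 𝟙-yes q? q = s≤s z≤n

  𝟙-cong : {P Q : Set} (p? : Dec P) (q? : Dec Q) → (P → Q) → (Q → P) → 𝟙 p? ≡ 𝟙 q?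
  𝟙-cong p? q? p⇒q q⇒p = ≤-antisym (𝟙-mono p? q? p⇒q) (𝟙-mono q? p? q⇒p)

  module _ {A : Set} where

    ∑-cong : (xs : List A) {f g : A → ℕ} → (∀ x → f x ≡ g x) → ∑ xs f ≡ ∑ xs g
    ∑-cong []       f≗g = refl
    ∑-cong (x ∷ xs) f≗g = cong₂ _+_ (f≗g x) (∑-cong xs f≗g)

    ∑-mono-≤ : (xs : List A) {f g : A → ℕ} → (∀ x → f x ≤ g x) → ∑ xs f ≤ ∑ xs g
    ∑-mono-≤ []       f≤g = z≤n
    ∑-mono-≤ (x ∷ xs) f≤g = +-mono-≤ (f≤g x) (∑-mono-≤ xs f≤g)

    ∑-mono-< : (xs : List A) {f g : A → ℕ} → (∀ x → f x ≤ g x) →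
               ∀ {x} → x ∈ xs → f x < g x → ∑ xs f < ∑ xs g
    ∑-mono-< (y ∷ xs) f≤g (here refl) fx<gx = +-mono-<-≤ fx<gx (∑-mono-≤ xs f≤g)
    ∑-mono-< (y ∷ xs) f≤g (there x∈)  fx<gx = +-mono-≤-< (f≤g y) (∑-mono-< xs f≤g x∈ fx<gx)

    ∈⇒≤∑ : (xs : List A) (f : A → ℕ) → ∀ {x} → x ∈ xs → f x ≤ ∑ xs f
    ∈⇒≤∑ (y ∷ xs) f (here refl) = m≤m+n (f y) (∑ xs f)
    ∈⇒≤∑ (y ∷ xs) f (there x∈)  = ≤-trans (∈⇒≤∑ xs f x∈) (m≤n+m (∑ xs f) (f y))

    ∑-distrib-+ : (xs : List A) (f g : A → ℕ) → ∑[ x ∈ xs ] (f x + g x) ≡ ∑ xs f + ∑ xs g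
    ∑-distrib-+ []       f g = refl
    ∑-distrib-+ (x ∷ xs) f g =
      trans (cong (f x + g x +_) (∑-distrib-+ xs f g)) (interchange (f x) (g x) (∑ xs f) (∑ xs g))

    ∑-*ˡ : (xs : List A) (c : ℕ) (f : A → ℕ) → ∑[ x ∈ xs ] (c * f x) ≡ c * ∑ xs f
    ∑-*ˡ []       c f = sym (*-zeroʳ c)
    ∑-*ˡ (x ∷ xs) c f = trans (cong (c * f x +_) (∑-*ˡ xs c f)) (sym (*-distribˡ-+ c (f x) (∑ xs f)))

    ∑-*ʳ : (xs : List A) (f : A → ℕ) (c : ℕ) → ∑[ x ∈ xs ] (f x * c) ≡ ∑ xs f * c
    ∑-*ʳ xs f c = trans (∑-cong xs (λ x → *-comm (f x) c)) (trans (∑-*ˡ xs c f) (*-comm c (∑ xs f)))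

    ∑-const : (xs : List A) (c : ℕ) → ∑[ x ∈ xs ] c ≡ length xs * c
    ∑-const []       c = refl
    ∑-const (x ∷ xs) c = cong (c +_) (∑-const xs c)

    ∑-++ : (xs ys : List A) (f : A → ℕ) → ∑ (xs ++ ys) f ≡ ∑ xs f + ∑ ys f
    ∑-++ []       ys f = refl
    ∑-++ (x ∷ xs) ys f = trans (cong (f x +_) (∑-++ xs ys f)) (sym (+-assoc (f x) (∑ xs f) (∑ ys f)))

    length-filter≡count : {P : A → Set} (P? : Decidable P) (xs : List A) → length (filter P? xs) ≡ count P? xs
    length-filter≡count P? []       = refl
    length-filter≡count P? (x ∷ xs) with P? x
    ... | yes _ = cong suc (length-filter≡count P? xs)
    ... | no  _ = length-filter≡count P? xs

    count-mono : {P Q : A → Set} (P? : Decidable P) (Q? : Decidable Q) (xs : List A) →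
                 (∀ {x} → x ∈ xs → P x → Q x) → count P? xs ≤ count Q? xs
    count-mono P? Q? []       P⇒Q = z≤n
    count-mono P? Q? (x ∷ xs) P⇒Q =
      +-mono-≤ (𝟙-mono (P? x) (Q? x) (P⇒Q (here refl))) (count-mono P? Q? xs (λ x∈ → P⇒Q (there x∈)))

    ∃-∑≤length* : A → (xs : List A) (f : A → ℕ) → ∃ λ x → ∑ xs f ≤ length xs * f x
    ∃-∑≤length* x₀ []       f = x₀ , z≤n
    ∃-∑≤length* x₀ (y ∷ ys) f with ∃-∑≤length* y ys f
    ... | x , ∑≤ with f x ≤? f y
    ...   | yes fx≤fy = y , +-monoʳ-≤ (f y) (≤-trans ∑≤ (*-monoʳ-≤ (length ys) fx≤fy))
    ...   | no  fx≰fy = x , +-mono-≤ (<⇒≤ (≰⇒> fx≰fy)) ∑≤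

    reverseMarkov : (xs : List A) (f : A → ℕ) {r b : ℕ} → 1 ≤ r → (∀ x → f x ≤ b) →
                    length xs * r ≤ ∑ xs f → length xs ≤ b * count (λ x → r ≤? f x) xs
    reverseMarkov xs f {r} {b} 1≤r f≤b avg≥r =
      +-cancelˡ-≤ (length xs * r) (length xs) (b * count (λ x → r ≤? f x) xs) (begin
        length xs * r + length xs                       ≤⟨ +-monoˡ-≤ (length xs) avg≥r ⟩
        ∑ xs f + length xs                              ≡⟨ cong (∑ xs f +_) (trans (sym (*-identityʳ _)) (sym (∑-const xs 1))) ⟩
        ∑ xs f + ∑[ x ∈ xs ] 1                          ≡⟨ ∑-distrib-+ xs f (λ _ → 1) ⟨
        ∑[ x ∈ xs ] (f x + 1)                           ≤⟨ ∑-mono-≤ xs (λ x → pointwise x (r ≤? f x)) ⟩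
        ∑[ x ∈ xs ] (r + b * 𝟙 (r ≤? f x))              ≡⟨ ∑-distrib-+ xs (λ _ → r) _ ⟩
        ∑[ x ∈ xs ] r + ∑[ x ∈ xs ] (b * 𝟙 (r ≤? f x))  ≡⟨ cong₂ _+_ (∑-const xs r) (∑-*ˡ xs b _) ⟩
        length xs * r + b * count (λ x → r ≤? f x) xs   ∎)
      where
      open ≤-Reasoning
      pointwise : ∀ x (r≤? : Dec (r ≤ f x)) → f x + 1 ≤ r + b * 𝟙 r≤?
      pointwise x (yes _) = begin
        f x + 1   ≤⟨ +-mono-≤ (f≤b x) 1≤r ⟩
        b + r     ≡⟨ cong (_+ r) (*-identityʳ b) ⟨
        b * 1 + r ≡⟨ +-comm (b * 1) r ⟩
        r + b * 1 ∎
      pointwise x (no r≰fx) = begin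
        f x + 1   ≡⟨ +-comm (f x) 1 ⟩
        suc (f x) ≤⟨ ≰⇒> r≰fx ⟩
        r         ≤⟨ m≤m+n r _ ⟩
        r + b * 0 ∎

  module _ {A B : Set} where

    ∑-map : (g : A → B) (xs : List A) (f : B → ℕ) → ∑ (map g xs) f ≡ ∑[ x ∈ xs ] f (g x)
    ∑-map g []       f = refl
    ∑-map g (x ∷ xs) f = cong (f (g x) +_) (∑-map g xs f)

    ∑-concatMap : (g : A → List B) (xs : List A) (f : B → ℕ) → ∑ (concatMap g xs) f ≡ ∑[ x ∈ xs ] ∑ (g x) f
    ∑-concatMap g []       f = refl
    ∑-concatMap g (x ∷ xs) f = trans (∑-++ (g x) _ f) (cong (∑ (g x) f +_) (∑-concatMap g xs f))

    ∑-comm : (xs : List A) (ys : List B) (f : A → B → ℕ) →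
             ∑[ x ∈ xs ] ∑[ y ∈ ys ] f x y ≡ ∑[ y ∈ ys ] ∑[ x ∈ xs ] f x y
    ∑-comm []       ys f = sym (trans (∑-const ys 0) (*-zeroʳ (length ys)))
    ∑-comm (x ∷ xs) ys f = trans (cong (∑ ys (f x) +_) (∑-comm xs ys f)) (sym (∑-distrib-+ ys (f x) _))

    length-cartesianProduct : (xs : List A) (ys : List B) → length (cartesianProduct xs ys) ≡ length xs * length ys
    length-cartesianProduct []       ys = refl
    length-cartesianProduct (x ∷ xs) ys = begin
      length (map (x ,_) ys ++ cartesianProduct xs ys)         ≡⟨ length-++ (map (x ,_) ys) ⟩
      length (map (x ,_) ys) + length (cartesianProduct xs ys) ≡⟨ cong₂ _+_ (length-map (x ,_) ys) (length-cartesianProduct xs ys) ⟩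
      length ys + length xs * length ys                        ∎
      where open ≡-Reasoning

  sum-map≡∑ : {A : Set} (f : A → ℕ) (xs : List A) → sum (map f xs) ≡ ∑ xs f
  sum-map≡∑ f []       = refl
  sum-map≡∑ f (x ∷ xs) = cong (f x +_) (sum-map≡∑ f xs)

  length-allFin : ∀ n → length (allFin n) ≡ n
  length-allFin n = length-tabulate id

  ∑-allFin-const : ∀ n c → ∑[ i ∈ allFin n ] c ≡ n * c
  ∑-allFin-const n c = trans (∑-const (allFin n) c) (cong (_* c) (length-allFin n))

  ∑-allFin-1 : ∀ n → ∑[ i ∈ allFin n ] 1 ≡ n
  ∑-allFin-1 n = trans (∑-allFin-const n 1) (*-identityʳ n)

  ∑-allFin-suc : ∀ n (f : Fin (suc n) → ℕ) → ∑ (allFin (suc n)) f ≡ f zero + ∑[ i ∈ allFin n ] f (suc i)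
  ∑-allFin-suc n f = cong (f zero +_) (trans (cong (λ xs → ∑ xs f) (sym (map-tabulate id suc))) (∑-map suc (allFin n) f))

  ∑-allFin-𝟙≡ : ∀ n (a : Fin n) (g : Fin n → ℕ) → ∑[ v ∈ allFin n ] (𝟙 (a Fin.≟ v) * g v) ≡ g a
  ∑-allFin-𝟙≡ (suc n) zero g = begin
    ∑[ v ∈ allFin (suc n) ] (𝟙 (zero Fin.≟ v) * g v) ≡⟨ ∑-allFin-suc n (λ v → 𝟙 (zero Fin.≟ v) * g v) ⟩
    g zero + 0 + ∑[ v ∈ allFin n ] 0                  ≡⟨ cong₂ _+_ (+-identityʳ (g zero)) (∑-allFin-const n 0) ⟩
    g zero + n * 0                                   ≡⟨ cong (g zero +_) (*-zeroʳ n) ⟩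
    g zero + 0                                       ≡⟨ +-identityʳ (g zero) ⟩
    g zero                                           ∎
    where open ≡-Reasoning
  ∑-allFin-𝟙≡ (suc n) (suc a) g = begin
    ∑[ v ∈ allFin (suc n) ] (𝟙 (suc a Fin.≟ v) * g v)      ≡⟨ ∑-allFin-suc n (λ v → 𝟙 (suc a Fin.≟ v) * g v) ⟩
    ∑[ v ∈ allFin n ] (𝟙 (suc a Fin.≟ suc v) * g (suc v)) ≡⟨ ∑-cong (allFin n) (λ v → cong (_* g (suc v))
                                                               (𝟙-cong (suc a Fin.≟ suc v) (a Fin.≟ v) Finₚ.suc-injective (cong suc))) ⟩
    ∑[ v ∈ allFin n ] (𝟙 (a Fin.≟ v) * g (suc v))         ≡⟨ ∑-allFin-𝟙≡ n a (λ v → g (suc v)) ⟩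
    g (suc a)                                             ∎
    where open ≡-Reasoning

module NatInRational where

  import Data.Nat as ℕ
  import Data.Nat.Properties as ℕ
  import Data.Nat.Coprimality as Coprime
  open import Data.Integer as ℤ using (+_)
  import Data.Integer.Properties as ℤ
  open import Data.Rational
  open import Data.Rational.Properties
  open import Algebra.Properties.AbelianGroup +-0-abelianGroup using (⁻¹-anti-homo‿-; xyx⁻¹≈y)
  import Data.Rational.Unnormalised as ℚᵘ
  import Data.Rational.Unnormalised.Properties as ℚᵘ
  open import Data.Empty using (⊥-elim)
  open import Relation.Binary.Definitions using (tri<; tri≈; tri>)
  open import Relation.Binary.PropositionalEquality

  ℕ→ℚ≡mkℚ : ∀ n → ℕ→ℚ n ≡ mkℚ (+ n) 0 (Coprime.sym (Coprime.1-coprimeTo n))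
  ℕ→ℚ≡mkℚ n = normalize-coprime (Coprime.sym (Coprime.1-coprimeTo n))

  toℚᵘ-ℕ→ℚ : ∀ n → toℚᵘ (ℕ→ℚ n) ℚᵘ.≃ ℚᵘ.mkℚᵘ (+ n) 0
  toℚᵘ-ℕ→ℚ n rewrite ℕ→ℚ≡mkℚ n = ℚᵘ.≃-refl

  ℕ→ℚ-+ : ∀ a b → ℕ→ℚ (a ℕ.+ b) ≡ ℕ→ℚ a + ℕ→ℚ b
  ℕ→ℚ-+ a b = toℚᵘ-injective (begin
    toℚᵘ (ℕ→ℚ (a ℕ.+ b))                  ≈⟨ toℚᵘ-ℕ→ℚ (a ℕ.+ b) ⟩
    ℚᵘ.mkℚᵘ (+ (a ℕ.+ b)) 0               ≈⟨ ℚᵘ.*≡* (cong (ℤ._* ℤ.1ℤ) (trans (ℤ.pos-+ a b)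
                                               (sym (cong₂ ℤ._+_ (ℤ.*-identityʳ (+ a)) (ℤ.*-identityʳ (+ b)))))) ⟩
    ℚᵘ.mkℚᵘ (+ a) 0 ℚᵘ.+ ℚᵘ.mkℚᵘ (+ b) 0  ≈⟨ ℚᵘ.+-cong (toℚᵘ-ℕ→ℚ a) (toℚᵘ-ℕ→ℚ b) ⟨
    toℚᵘ (ℕ→ℚ a) ℚᵘ.+ toℚᵘ (ℕ→ℚ b)        ≈⟨ toℚᵘ-homo-+ (ℕ→ℚ a) (ℕ→ℚ b) ⟨
    toℚᵘ (ℕ→ℚ a + ℕ→ℚ b)                  ∎)
    where open ℚᵘ.≃-Reasoning

  ℕ→ℚ-* : ∀ a b → ℕ→ℚ (a ℕ.* b) ≡ ℕ→ℚ a * ℕ→ℚ b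
  ℕ→ℚ-* a b = toℚᵘ-injective (begin
    toℚᵘ (ℕ→ℚ (a ℕ.* b))                  ≈⟨ toℚᵘ-ℕ→ℚ (a ℕ.* b) ⟩
    ℚᵘ.mkℚᵘ (+ (a ℕ.* b)) 0               ≈⟨ ℚᵘ.*≡* (cong (ℤ._* ℤ.1ℤ) (ℤ.pos-* a b)) ⟩
    ℚᵘ.mkℚᵘ (+ a) 0 ℚᵘ.* ℚᵘ.mkℚᵘ (+ b) 0  ≈⟨ ℚᵘ.*-cong (toℚᵘ-ℕ→ℚ a) (toℚᵘ-ℕ→ℚ b) ⟨
    toℚᵘ (ℕ→ℚ a) ℚᵘ.* toℚᵘ (ℕ→ℚ b)        ≈⟨ toℚᵘ-homo-* (ℕ→ℚ a) (ℕ→ℚ b) ⟨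
    toℚᵘ (ℕ→ℚ a * ℕ→ℚ b)                  ∎)
    where open ℚᵘ.≃-Reasoning

  ℕ→ℚ-mono-≤ : ∀ {a b} → a ℕ.≤ b → ℕ→ℚ a ≤ ℕ→ℚ b
  ℕ→ℚ-mono-≤ {a} {b} a≤b rewrite ℕ→ℚ≡mkℚ a | ℕ→ℚ≡mkℚ b =
    *≤* (subst₂ ℤ._≤_ (sym (ℤ.*-identityʳ (+ a))) (sym (ℤ.*-identityʳ (+ b))) (ℤ.+≤+ a≤b))

  ℕ→ℚ-cancel-< : ∀ {a b} → ℕ→ℚ a < ℕ→ℚ b → a ℕ.< b
  ℕ→ℚ-cancel-< {a} {b} a<b rewrite ℕ→ℚ≡mkℚ a | ℕ→ℚ≡mkℚ b with a<b
  ... | *<* a*1<b*1 = ℤ.+◃-cancel-< (subst₂ ℤ._<_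
          (trans (ℤ.*-identityʳ (+ a)) (sym (ℤ.+◃n≡+n a)))
          (trans (ℤ.*-identityʳ (+ b)) (sym (ℤ.+◃n≡+n b))) a*1<b*1)

  ∣p-q∣≡∣q-p∣ : ∀ p q → ∣ p - q ∣ ≡ ∣ q - p ∣
  ∣p-q∣≡∣q-p∣ p q = trans (cong ∣_∣ (sym (⁻¹-anti-homo‿- q p))) (∣-p∣≡∣p∣ (q - p))

  1≤∣ℕ→ℚ-ℕ→ℚ∣-< : ∀ {a b} → a ℕ.< b → 1ℚ ≤ ∣ ℕ→ℚ b - ℕ→ℚ a ∣
  1≤∣ℕ→ℚ-ℕ→ℚ∣-< {a} {b} a<b = begin
    1ℚ
      ≤⟨ ℕ→ℚ-mono-≤ (ℕ.m<n⇒0<n∸m a<b) ⟩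
    ℕ→ℚ (b ℕ.∸ a)
      ≡⟨ 0≤p⇒∣p∣≡p (ℕ→ℚ-mono-≤ {0} {b ℕ.∸ a} ℕ.z≤n) ⟨
    ∣ ℕ→ℚ (b ℕ.∸ a) ∣
      ≡⟨ cong ∣_∣ (xyx⁻¹≈y (ℕ→ℚ a) (ℕ→ℚ (b ℕ.∸ a))) ⟨
    ∣ ℕ→ℚ a + ℕ→ℚ (b ℕ.∸ a) - ℕ→ℚ a ∣
      ≡⟨ cong (λ x → ∣ x - ℕ→ℚ a ∣) (ℕ→ℚ-+ a (b ℕ.∸ a)) ⟨
    ∣ ℕ→ℚ (a ℕ.+ (b ℕ.∸ a)) - ℕ→ℚ a ∣
      ≡⟨ cong (λ x → ∣ ℕ→ℚ x - ℕ→ℚ a ∣) (ℕ.m+[n∸m]≡n (ℕ.<⇒≤ a<b)) ⟩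
    ∣ ℕ→ℚ b - ℕ→ℚ a ∣
      ∎
    where open ≤-Reasoning

  1≤∣ℕ→ℚ-ℕ→ℚ∣ : ∀ {a b} → a ≢ b → 1ℚ ≤ ∣ ℕ→ℚ a - ℕ→ℚ b ∣
  1≤∣ℕ→ℚ-ℕ→ℚ∣ {a} {b} a≢b with ℕ.<-cmp a b
  ... | tri< a<b _ _ = subst (1ℚ ≤_) (∣p-q∣≡∣q-p∣ (ℕ→ℚ b) (ℕ→ℚ a)) (1≤∣ℕ→ℚ-ℕ→ℚ∣-< a<b)
  ... | tri≈ _ a≡b _ = ⊥-elim (a≢b a≡b)
  ... | tri> _ _ b<a = 1≤∣ℕ→ℚ-ℕ→ℚ∣-< b<a

  q*s<N : ∀ {q s N ε} → 0 ℕ.< N → ℕ→ℚ q * ε < 1ℚ → ℕ→ℚ s ≤ ε * ℕ→ℚ N → q ℕ.* s ℕ.< N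
  q*s<N {q} {s} {N} {ε} 0<N qε<1 s≤εN = ℕ→ℚ-cancel-< (begin-strict
    ℕ→ℚ (q ℕ.* s)        ≡⟨ ℕ→ℚ-* q s ⟩
    ℕ→ℚ q * ℕ→ℚ s        ≤⟨ *-monoˡ-≤-nonNeg (ℕ→ℚ q) s≤εN ⟩
    ℕ→ℚ q * (ε * ℕ→ℚ N)  ≡⟨ *-assoc (ℕ→ℚ q) ε (ℕ→ℚ N) ⟨
    ℕ→ℚ q * ε * ℕ→ℚ N    <⟨ *-monoˡ-<-pos (ℕ→ℚ N) qε<1 ⟩
    1ℚ * ℕ→ℚ N           ≡⟨ *-identityˡ (ℕ→ℚ N) ⟩
    ℕ→ℚ N                ∎)
    where
    open ≤-Reasoning
    instance
      _ : NonNegative (ℕ→ℚ q)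
      _ = nonNegative (ℕ→ℚ-mono-≤ {0} {q} ℕ.z≤n)
      _ : Positive (ℕ→ℚ N)
      _ = positive (<-≤-trans (*<* (ℤ.+<+ (ℕ.s≤s ℕ.z≤n))) (ℕ→ℚ-mono-≤ {1} {N} 0<N))

module ExtendedRational where

  open import Data.Rational using (_+_)
  open import Data.Rational.Properties using (≤-trans; ≤-total; p≤q⇒p⊓q≡p; p≥q⇒p⊓q≡q; +-mono-≤)
  open import Data.Sum using (inj₁; inj₂)

  ≤∞-trans : ∀ {x y z} → x ≤∞ y → y ≤∞ z → x ≤∞ z
  ≤∞-trans (fin≤fin p≤q) (fin≤fin q≤s) = fin≤fin (≤-trans p≤q q≤s)
  ≤∞-trans _             x≤∞           = x≤∞

  ⊓∞-glb : ∀ {c x y} → fin c ≤∞ x → fin c ≤∞ y → fin c ≤∞ (x ⊓∞ y)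
  ⊓∞-glb {x = fin a} {fin b} (fin≤fin c≤a) (fin≤fin c≤b) with ≤-total a b
  ... | inj₁ a≤b rewrite p≤q⇒p⊓q≡p a≤b = fin≤fin c≤a
  ... | inj₂ b≤a rewrite p≥q⇒p⊓q≡q b≤a = fin≤fin c≤b
  ⊓∞-glb {x = fin a} {∞} c≤x _   = c≤x
  ⊓∞-glb {x = ∞}         _   c≤y = c≤y

  +∞-mono : ∀ {a b x y} → fin a ≤∞ x → fin b ≤∞ y → fin (a + b) ≤∞ (x +∞ y)
  +∞-mono (fin≤fin a≤p) (fin≤fin b≤q) = fin≤fin (+-mono-≤ a≤p b≤q)
  +∞-mono (fin≤fin _)   x≤∞           = x≤∞
  +∞-mono x≤∞           _             = x≤∞

module PartitionSystems where

  open FiniteSums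
  open PartitionSystem
  open import Data.Empty using (⊥-elim)
  import Data.Fin as Fin
  import Data.Fin.Properties as Finₚ
  open import Data.List using (List)
  open import Data.List.Membership.Propositional using (_∈_; find; lose)
  open import Data.List.Relation.Unary.Any using (any?)
  open import Data.Nat using (zero; suc; _≤_; _<_; z≤n; s≤s)
  import Data.Nat.Properties as ℕ
  open import Data.Product using (Σ; ∃; _×_; _,_; proj₁; proj₂)
  open import Data.Sum using (_⊎_; inj₁; inj₂; [_,_])
  open import Data.Vec.Functional using (_∷_)
  open import Function.Definitions using (Injective)
  open import Relation.Nullary using (¬_; yes; no)
  open import Relation.Nullary.Decidable using (¬?; _×-dec_; decidable-stable)
  open import Relation.Unary using (Decidable)
  open import Relation.Binary.PropositionalEquality hiding ([_])

  Image : ∀ {s n} → (Fin s → Fin n) → Fin n → Set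
  Image c y = ∃ λ i → c i ≡ y

  image? : ∀ {s n} (c : Fin s → Fin n) → Decidable (Image c)
  image? c y = Finₚ.any? (λ i → c i Fin.≟ y)

  Image-∷ : ∀ {s n} (y : Fin n) (c : Fin s → Fin n) {x} → Image c x → Image (y ∷ c) x
  Image-∷ y c (i , ci≡x) = Fin.suc i , ci≡x

  ∃-∉-image : ∀ {s n} → s < n → (c : Fin s → Fin n) → ∃ λ y → ¬ Image c y
  ∃-∉-image s<n c with Finₚ.any? (λ y → ¬? (image? c y))
  ... | yes y∉ = y∉
  ... | no  ∄y∉ = ⊥-elim (ℕ.<⇒≱ s<n (Finₚ.injective⇒≤ preimage-injective))
    where
    preimage : ∀ y → Image c y
    preimage y = decidable-stable (image? c y) (λ y∉ → ∄y∉ (y , y∉))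
    preimage-injective : Injective _≡_ _≡_ (λ y → proj₁ (preimage y))
    preimage-injective {y} {y′} same = trans (sym (proj₂ (preimage y))) (trans (cong c same) (proj₂ (preimage y′)))

  ∷-injective : ∀ {s n} {y : Fin n} {c : Fin s → Fin n} → Injective _≡_ _≡_ c → ¬ Image c y → Injective _≡_ _≡_ (y ∷ c)
  ∷-injective c-inj y∉ {Fin.zero}  {Fin.zero}  _  = refl
  ∷-injective c-inj y∉ {Fin.zero}  {Fin.suc j} eq = ⊥-elim (y∉ (j , sym eq))
  ∷-injective c-inj y∉ {Fin.suc i} {Fin.zero}  eq = ⊥-elim (y∉ (i , eq))
  ∷-injective c-inj y∉ {Fin.suc i} {Fin.suc j} eq = cong Fin.suc (c-inj eq)

  catches? : ∀ {r C m} (P : PartitionSystem r C m) {A : Set} (tag : A → Fin r) (colour : A → Fin C)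
             {I : A → Set} → Decidable I → (z : Fin m) → Decidable (λ a → I a × part P (colour a) z ≡ tag a)
  catches? P tag colour I? z a = I? a ×-dec (part P (colour a) z Fin.≟ tag a)

  module _ {r C m} (P : PartitionSystem r C m) {A : Set} (tag : A → Fin r) (colour : A → Fin C)
           {I : A → Set} (I? : Decidable I) (xs : List A)
           (colour⇒tag : ∀ {a b} → a ∈ xs → b ∈ xs → I a → I b → colour a ≡ colour b → tag a ≡ tag b) where

    private
      Coloured : ∀ {s} → (Fin s → Fin C) → A → Set
      Coloured c a = I a × Image c (colour a)

      coloured? : ∀ {s} (c : Fin s → Fin C) → Decidable (Coloured c)
      coloured? c a = I? a ×-dec image? c (colour a)

      #coloured : ∀ {s} → (Fin s → Fin C) → ℕ
      #coloured c = count (coloured? c) xs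

      #coloured-∷ : ∀ {s} y (c : Fin s → Fin C) → #coloured c ≤ #coloured (y ∷ c)
      #coloured-∷ y c = count-mono (coloured? c) (coloured? (y ∷ c)) xs (λ _ (Ia , im) → Ia , Image-∷ y c im)

      fresh-colour : ∀ {s} (c : Fin s → Fin C) → s < C →
                     Σ (Fin C) λ y → ¬ Image c y × (#coloured c < #coloured (y ∷ c) ⊎ count I? xs ≤ #coloured c)
      fresh-colour c s<C with any? (λ a → I? a ×-dec ¬? (image? c (colour a))) xs
      ... | yes uncoloured =
        let a , a∈xs , Ia , a∉ = find uncoloured in
        colour a , a∉ ,
        inj₁ (∑-mono-< xs (λ x → 𝟙-mono (coloured? c x) (coloured? (colour a ∷ c) x) (λ (Ix , im) → Ix , Image-∷ (colour a) c im))
                 a∈xs (𝟙-< (coloured? c a) (coloured? (colour a ∷ c) a) (λ (_ , im) → a∉ im) (Ia , Fin.zero , refl)))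
      ... | no  ∄uncoloured =
        let y , y∉ = ∃-∉-image s<C c in
        y , y∉ , inj₂ (count-mono I? (coloured? c) xs λ x∈xs Ix →
          Ix , decidable-stable (image? c _) (λ x∉ → ∄uncoloured (lose x∈xs (Ix , x∉))))

      -- Each new colour occurs on an item not yet coloured, until no such item is left.
      greedy : ∀ s → s ≤ r → r ≤ C →
               Σ (Fin s → Fin C) λ c → Injective _≡_ _≡_ c × (s ≤ #coloured c ⊎ count I? xs ≤ #coloured c)
      greedy zero    _     _   = (λ ()) , (λ {i} → ⊥-elim (Finₚ.¬Fin0 i)) , inj₁ z≤n
      greedy (suc s) 1+s≤r r≤C with greedy s (ℕ.<⇒≤ 1+s≤r) r≤C
      ... | c , c-inj , progress with fresh-colour c (ℕ.<-≤-trans 1+s≤r r≤C)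
      ...   | y , y∉ , gain = y ∷ c , ∷-injective c-inj y∉ , combine progress gain
        where
        combine : s ≤ #coloured c ⊎ count I? xs ≤ #coloured c → #coloured c < #coloured (y ∷ c) ⊎ count I? xs ≤ #coloured c →
                  suc s ≤ #coloured (y ∷ c) ⊎ count I? xs ≤ #coloured (y ∷ c)
        combine (inj₁ s≤#c)  (inj₁ #c<#c′) = inj₁ (ℕ.≤-trans (s≤s s≤#c) #c<#c′)
        combine _            (inj₂ #I≤#c)  = inj₂ (ℕ.≤-trans #I≤#c (#coloured-∷ y c))
        combine (inj₂ #I≤#c) _             = inj₂ (ℕ.≤-trans #I≤#c (#coloured-∷ y c))

      tagOf : Fin C → Fin r → Fin r
      tagOf y default with any? (λ a → I? a ×-dec colour a Fin.≟ y) xs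
      ... | yes found = tag (proj₁ (find found))
      ... | no  _     = default

      tagOf-colour : ∀ {a} default → a ∈ xs → I a → tagOf (colour a) default ≡ tag a
      tagOf-colour {a} default a∈xs Ia with any? (λ b → I? b ×-dec colour b Fin.≟ colour a) xs
      ... | yes found = let _ , b∈xs , Ib , same = find found in colour⇒tag b∈xs a∈xs Ib Ia same
      ... | no  ∄b    = ⊥-elim (∄b (lose a∈xs (Ia , refl)))

    ∃-point-catching-r : r ≤ C → r ≤ count I? xs → ∃ λ z → r ≤ count (catches? P tag colour I? z) xs
    ∃-point-catching-r r≤C r≤#I with greedy r ℕ.≤-refl r≤C
    ... | c , c-inj , progress with cover P c c-inj (λ i → tagOf (c i) i)
    ...   | z , z∈parts = z , ℕ.≤-trans r≤#coloured (count-mono (coloured? c) (catches? P tag colour I? z) xs caught)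
      where
      r≤#coloured : r ≤ #coloured c
      r≤#coloured = [ (λ r≤ → r≤) , ℕ.≤-trans r≤#I ] progress
      caught : ∀ {a} → a ∈ xs → Coloured c a → I a × part P (colour a) z ≡ tag a
      caught {a} a∈xs (Ia , i , ci≡colour) = Ia , (begin
        part P (colour a) z ≡⟨ cong (λ y → part P y z) ci≡colour ⟨
        part P (c i) z      ≡⟨ z∈parts i ⟩
        tagOf (c i) i       ≡⟨ cong (λ y → tagOf y i) ci≡colour ⟩
        tagOf (colour a) i  ≡⟨ tagOf-colour i a∈xs Ia ⟩
        tag a               ∎)
        where open ≡-Reasoning

module LabelCover {r : ℕ} (G : HLC r) where

  open HLC G
  open FiniteSums
  open import Data.Nat using (_*_; _<_)
  import Data.Fin as Fin
  import Data.Fin.Properties as Finₚ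
  open import Data.List using (List; map; concatMap; allFin)
  open import Data.Product using (Σ; _,_)
  open import Relation.Binary.PropositionalEquality

  fewColours⇒weaklySatisfied : nC < r → (σ : Labeling G) → ∀ h → WeaklySatisfied G σ h
  fewColours⇒weaklySatisfied nC<r σ h with Finₚ.pigeonhole nC<r (λ j → π h j (σ j (edge h j)))
  ... | j , j′ , j<j′ , sameColour = j , j′ , (λ j≡j′ → Finₚ.<-irrefl j≡j′ j<j′) , sameColour

  numSatisfied≡count : ∀ σ → numSatisfied G σ ≡ count (weaklySatisfied? G σ) (allFin nE)
  numSatisfied≡count σ = length-filter≡count (weaklySatisfied? G σ) (allFin nE)

  allSatisfied⇒numSatisfied≡nE : ∀ σ → (∀ h → WeaklySatisfied G σ h) → numSatisfied G σ ≡ nE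
  allSatisfied⇒numSatisfied≡nE σ satisfied =
    trans (numSatisfied≡count σ)
      (trans (∑-cong (allFin nE) (λ h → 𝟙-yes (weaklySatisfied? G σ h) (satisfied h))) (∑-allFin-1 nE))

  ∑-edges≡degree*∑-vertices : ∀ {D} → (∀ j v → degree G j v ≡ D) → (g : (j : Fin r) → Fin (nV j) → ℕ) →
    ∑[ h ∈ allFin nE ] ∑[ j ∈ allFin r ] g j (edge h j) ≡ D * ∑[ j ∈ allFin r ] ∑[ v ∈ allFin (nV j) ] g j v
  ∑-edges≡degree*∑-vertices {D} regular g = begin
    ∑[ h ∈ allFin nE ] ∑[ j ∈ allFin r ] g j (edge h j)  ≡⟨ ∑-comm (allFin nE) (allFin r) (λ h j → g j (edge h j)) ⟩
    ∑[ j ∈ allFin r ] ∑[ h ∈ allFin nE ] g j (edge h j)  ≡⟨ ∑-cong (allFin r) part ⟩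
    ∑[ j ∈ allFin r ] (D * ∑[ v ∈ allFin (nV j) ] g j v) ≡⟨ ∑-*ˡ (allFin r) D _ ⟩
    D * ∑[ j ∈ allFin r ] ∑[ v ∈ allFin (nV j) ] g j v   ∎
    where
    open ≡-Reasoning
    part : ∀ j → ∑[ h ∈ allFin nE ] g j (edge h j) ≡ D * ∑[ v ∈ allFin (nV j) ] g j v
    part j = begin
      ∑[ h ∈ allFin nE ] g j (edge h j)
        ≡⟨ ∑-cong (allFin nE) (λ h → ∑-allFin-𝟙≡ (nV j) (edge h j) (g j)) ⟨
      ∑[ h ∈ allFin nE ] ∑[ v ∈ allFin (nV j) ] (𝟙 (edge h j Fin.≟ v) * g j v)
        ≡⟨ ∑-comm (allFin nE) (allFin (nV j)) _ ⟩
      ∑[ v ∈ allFin (nV j) ] ∑[ h ∈ allFin nE ] (𝟙 (edge h j Fin.≟ v) * g j v)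
        ≡⟨ ∑-cong (allFin (nV j)) (λ v → ∑-*ʳ (allFin nE) (λ h → 𝟙 (edge h j Fin.≟ v)) (g j v)) ⟩
      ∑[ v ∈ allFin (nV j) ] (count (λ h → edge h j Fin.≟ v) (allFin nE) * g j v)
        ≡⟨ ∑-cong (allFin (nV j)) (λ v → cong (_* g j v)
             (trans (sym (length-filter≡count (λ h → edge h j Fin.≟ v) (allFin nE))) (regular j v))) ⟩
      ∑[ v ∈ allFin (nV j) ] (D * g j v)
        ≡⟨ ∑-*ˡ (allFin (nV j)) D (g j) ⟩
      D * ∑[ v ∈ allFin (nV j) ] g j v
        ∎

  PartLabel : Set
  PartLabel = Σ (Fin r) (λ j → Fin (nL j))

  partLabels : List PartLabel
  partLabels = concatMap (λ j → map (j ,_) (allFin (nL j))) (allFin r)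

  ∑-partLabels : (f : PartLabel → ℕ) → ∑ partLabels f ≡ ∑[ j ∈ allFin r ] ∑[ ℓ ∈ allFin (nL j) ] f (j , ℓ)
  ∑-partLabels f = trans (∑-concatMap _ (allFin r) f) (∑-cong (allFin r) (λ j → ∑-map (j ,_) (allFin (nL j)) f))

module ClosedLocations {r : ℕ} (G : HLC r) (m : ℕ) (ps : Fin (HLC.nE G) → PartitionSystem r (HLC.nC G) m)
                       (F : Construction.Loc G m ps → Bool) where

  open HLC G
  open Construction G m ps
  open FiniteSums
  open LabelCover G
  open PartitionSystems
  open import Data.Bool using (true; false)
  import Data.Bool.Properties as Bool
  open import Data.Empty using (⊥-elim)
  import Data.Fin as Fin
  open import Data.List using (allFin)
  open import Data.List.Membership.Propositional using (_∈_; lose)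
  open import Data.List.Membership.Propositional.Properties using (∈-allFin)
  open import Data.List.Relation.Unary.Any as Any using (any?)
  open import Data.Nat using (_+_; _*_; _∸_; _≤_; _<_; _≤?_)
  import Data.Nat.Properties as ℕ
  open import Data.Product using (∃₂; _×_; _,_; proj₁; proj₂)
  open import Function using (id)
  open import Relation.Nullary using (Dec; yes; no)
  open import Relation.Nullary.Decidable using (_×-dec_; ¬?)
  open import Relation.Unary using (Decidable)
  open import Relation.Binary.PropositionalEquality

  Closed : Loc → Set
  Closed x = F x ≡ false

  closed? : Decidable Closed
  closed? x = F x Bool.≟ false

  unopened : Elem → ℕ
  unopened e = count (λ x → e ∈X? x ×-dec closed? x) allLocs

  #closed : (j : Fin r) → Fin (nV j) → ℕ
  #closed j v = count (λ ℓ → closed? (j , v , ℓ)) (allFin (nL j))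

  at : Fin nE → PartLabel → Loc
  at h (j , ℓ) = j , edge h j , ℓ

  colour : Fin nE → PartLabel → Fin nC
  colour h (j , ℓ) = π h j ℓ

  #closedOnEdge : Fin nE → ℕ
  #closedOnEdge h = ∑[ j ∈ allFin r ] #closed j (edge h j)

  ∑-allLocs : (f : Loc → ℕ) →
              ∑ allLocs f ≡ ∑[ j ∈ allFin r ] ∑[ v ∈ allFin (nV j) ] ∑[ ℓ ∈ allFin (nL j) ] f (j , v , ℓ)
  ∑-allLocs f = trans (∑-concatMap _ (allFin r) f) (∑-cong (allFin r) λ j →
                trans (∑-concatMap _ (allFin (nV j)) f) (∑-cong (allFin (nV j)) λ v →
                ∑-map _ (allFin (nL j)) f))

  ∑-edge≤∑-allLocs : ∀ h (f : Loc → ℕ) → ∑[ a ∈ partLabels ] f (at h a) ≤ ∑ allLocs f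
  ∑-edge≤∑-allLocs h f = begin
    ∑[ a ∈ partLabels ] f (at h a)                                         ≡⟨ ∑-partLabels (λ a → f (at h a)) ⟩
    ∑[ j ∈ allFin r ] ∑[ ℓ ∈ allFin (nL j) ] f (j , edge h j , ℓ)            ≤⟨ ∑-mono-≤ (allFin r) (λ j →
                                                                                 ∈⇒≤∑ (allFin (nV j)) _ (∈-allFin (edge h j))) ⟩
    ∑[ j ∈ allFin r ] ∑[ v ∈ allFin (nV j) ] ∑[ ℓ ∈ allFin (nL j) ] f (j , v , ℓ) ≡⟨ ∑-allLocs f ⟨
    ∑ allLocs f                                                             ∎
    where open ℕ.≤-Reasoning

  numLocs≡∑1 : numLocs ≡ ∑[ x ∈ allLocs ] 1
  numLocs≡∑1 = trans (sym (ℕ.*-identityʳ numLocs)) (sym (∑-const allLocs 1))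

  t≡∑∑1 : t ≡ ∑[ j ∈ allFin r ] ∑[ v ∈ allFin (nV j) ] 1
  t≡∑∑1 = trans (sum-map≡∑ nV (allFin r)) (∑-cong (allFin r) λ j → sym (∑-allFin-1 (nV j)))

  t≤numLocs : (∀ j → 0 < nL j) → t ≤ numLocs
  t≤numLocs labels-nonempty = begin
    t
      ≡⟨ t≡∑∑1 ⟩
    ∑[ j ∈ allFin r ] ∑[ v ∈ allFin (nV j) ] 1
      ≤⟨ ∑-mono-≤ (allFin r) (λ j → ∑-mono-≤ (allFin (nV j)) λ _ →
           ℕ.≤-trans (labels-nonempty j) (ℕ.≤-reflexive (sym (∑-allFin-1 (nL j))))) ⟩
    ∑[ j ∈ allFin r ] ∑[ v ∈ allFin (nV j) ] ∑[ ℓ ∈ allFin (nL j) ] 1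
      ≡⟨ ∑-allLocs (λ _ → 1) ⟨
    ∑[ x ∈ allLocs ] 1
      ≡⟨ numLocs≡∑1 ⟨
    numLocs
      ∎
    where open ℕ.≤-Reasoning

  ∑-#closed≡t : (∀ j → 0 < nL j) → size F ≡ k → ∑[ j ∈ allFin r ] ∑[ v ∈ allFin (nV j) ] #closed j v ≡ t
  ∑-#closed≡t labels-nonempty |F|≡k = begin
    ∑[ j ∈ allFin r ] ∑[ v ∈ allFin (nV j) ] #closed j v ≡⟨ ∑-allLocs (λ x → 𝟙 (closed? x)) ⟨
    #closedLocs                                       ≡⟨ ℕ.m+n∸m≡n (size F) #closedLocs ⟨
    size F + #closedLocs ∸ size F                     ≡⟨ cong₂ _∸_ size+#closed≡numLocs |F|≡k ⟩
    numLocs ∸ (numLocs ∸ t)                           ≡⟨ ℕ.m∸[m∸n]≡n (t≤numLocs labels-nonempty) ⟩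
    t                                                 ∎
    where
    open ≡-Reasoning
    #closedLocs : ℕ
    #closedLocs = count closed? allLocs
    open-or-closed : ∀ x → 𝟙 (Bool.T? (F x)) + 𝟙 (closed? x) ≡ 1
    open-or-closed x with F x
    ... | true  = refl
    ... | false = refl
    size+#closed≡numLocs : size F + #closedLocs ≡ numLocs
    size+#closed≡numLocs = begin
      size F + #closedLocs
        ≡⟨ cong (_+ #closedLocs) (length-filter≡count (λ x → Bool.T? (F x)) allLocs) ⟩
      count (λ x → Bool.T? (F x)) allLocs + #closedLocs         ≡⟨ ∑-distrib-+ allLocs _ _ ⟨
      ∑[ x ∈ allLocs ] (𝟙 (Bool.T? (F x)) + 𝟙 (closed? x))      ≡⟨ ∑-cong allLocs open-or-closed ⟩
      ∑[ x ∈ allLocs ] 1                                         ≡⟨ numLocs≡∑1 ⟨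
      numLocs                                                    ∎

  ∑-#closedOnEdge≡nE*r : (∀ j → 0 < nL j) → size F ≡ k → Regular G → ∑[ h ∈ allFin nE ] #closedOnEdge h ≡ nE * r
  ∑-#closedOnEdge≡nE*r labels-nonempty |F|≡k (D , regular) = begin
    ∑[ h ∈ allFin nE ] #closedOnEdge h                       ≡⟨ ∑-edges≡degree*∑-vertices regular #closed ⟩
    D * ∑[ j ∈ allFin r ] ∑[ v ∈ allFin (nV j) ] #closed j v
      ≡⟨ cong (D *_) (trans (∑-#closed≡t labels-nonempty |F|≡k) t≡∑∑1) ⟩
    D * ∑[ j ∈ allFin r ] ∑[ v ∈ allFin (nV j) ] 1           ≡⟨ ∑-edges≡degree*∑-vertices regular (λ _ _ → 1) ⟨
    ∑[ h ∈ allFin nE ] ∑[ j ∈ allFin r ] 1                   ≡⟨ ∑-cong (allFin nE) (λ _ → ∑-allFin-1 r) ⟩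
    ∑[ h ∈ allFin nE ] r                                     ≡⟨ ∑-allFin-const nE r ⟩
    nE * r                                                   ∎
    where open ≡-Reasoning

  Clash : Fin nE → PartLabel → PartLabel → Set
  Clash h a b = proj₁ a ≢ proj₁ b × Closed (at h a) × Closed (at h b) × colour h a ≡ colour h b

  clash? : ∀ h a b → Dec (Clash h a b)
  clash? h a b = ¬? (proj₁ a Fin.≟ proj₁ b) ×-dec closed? (at h a) ×-dec closed? (at h b) ×-dec (colour h a Fin.≟ colour h b)

  module _ (r≤nC : r ≤ nC) (fewUnopened : ∀ e → unopened e < r) where

    private
      colour⇒part⇒count<r : ∀ h {I : PartLabel → Set} (I? : Decidable I) → (∀ {a} → I a → Closed (at h a)) →
                (∀ {a b} → a ∈ partLabels → b ∈ partLabels → I a → I b → colour h a ≡ colour h b → proj₁ a ≡ proj₁ b) →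
                count I? partLabels < r
      colour⇒part⇒count<r h I? closed colour⇒part with r ≤? count I? partLabels
      ... | no  r≰count = ℕ.≰⇒> r≰count
      ... | yes r≤count with ∃-point-catching-r (ps h) proj₁ (colour h) I? partLabels colour⇒part r≤nC r≤count
      ...   | z , r≤caught = ⊥-elim (ℕ.<⇒≱ (fewUnopened (h , z)) (ℕ.≤-trans r≤caught caught≤unopened))
        where
        caught≤unopened : count (catches? (ps h) proj₁ (colour h) I? z) partLabels ≤ unopened (h , z)
        caught≤unopened = ℕ.≤-trans
          (count-mono (catches? (ps h) proj₁ (colour h) I? z) (λ a → (h , z) ∈X? at h a ×-dec closed? (at h a)) partLabels
                      (λ _ (Ia , caught) → (refl , caught) , closed Ia))
          (∑-edge≤∑-allLocs h (λ x → 𝟙 ((h , z) ∈X? x ×-dec closed? x)))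

    #closed<r : ∀ h j → #closed j (edge h j) < r
    #closed<r h j = ℕ.≤-<-trans #closed≤ (colour⇒part⇒count<r h I? proj₂ (λ _ _ (j≡ , _) (j≡′ , _) _ → trans j≡ (sym j≡′)))
      where
      I : PartLabel → Set
      I a = proj₁ a ≡ j × Closed (at h a)
      I? : Decidable I
      I? a = (proj₁ a Fin.≟ j) ×-dec closed? (at h a)
      #closed≤ : #closed j (edge h j) ≤ count I? partLabels
      #closed≤ = begin
        #closed j (edge h j)
          ≡⟨ ∑-cong (allFin (nL j)) (λ ℓ → 𝟙-cong (closed? _) (I? (j , ℓ)) (refl ,_) proj₂) ⟩
        ∑[ ℓ ∈ allFin (nL j) ] 𝟙 (I? (j , ℓ))
          ≤⟨ ∈⇒≤∑ (allFin r) (λ j′ → ∑[ ℓ ∈ allFin (nL j′) ] 𝟙 (I? (j′ , ℓ))) (∈-allFin j) ⟩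
        ∑[ j′ ∈ allFin r ] ∑[ ℓ ∈ allFin (nL j′) ] 𝟙 (I? (j′ , ℓ))
          ≡⟨ ∑-partLabels (λ a → 𝟙 (I? a)) ⟨
        count I? partLabels
          ∎
        where open ℕ.≤-Reasoning

    ∃-clash : ∀ h → r ≤ #closedOnEdge h → ∃₂ (Clash h)
    ∃-clash h r≤ with any? (λ a → any? (clash? h a) partLabels) partLabels
    ... | yes found = let a , found′ = Any.satisfied found in a , Any.satisfied found′
    ... | no  ∄clash = ⊥-elim (ℕ.≤⇒≯ r≤ (subst (_< r) (∑-partLabels (λ a → 𝟙 (closed? (at h a))))
                                              (colour⇒part⇒count<r h (λ a → closed? (at h a)) id colour⇒part)))
      where
      colour⇒part : ∀ {a b} → a ∈ partLabels → b ∈ partLabels → Closed (at h a) → Closed (at h b) →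
                    colour h a ≡ colour h b → proj₁ a ≡ proj₁ b
      colour⇒part {a} {b} a∈ b∈ a-closed b-closed same with proj₁ a Fin.≟ proj₁ b
      ... | yes a≡b = a≡b
      ... | no  a≢b = ⊥-elim (∄clash (lose a∈ (lose b∈ (a≢b , a-closed , b-closed , same))))

module ClientCost {r : ℕ} (G : HLC r) (m : ℕ) (ps : Fin (HLC.nE G) → PartitionSystem r (HLC.nC G) m)
                  (pos : Construction.Loc G m ps → ℚ) (placement : Construction.LinePlacement G m ps pos)
                  (F : Construction.Loc G m ps → Bool) where

  open Construction G m ps
  open ClosedLocations G m ps F
  open FiniteSums
  open NatInRational
  open ExtendedRational
  open import Data.Bool using (true; false; if_then_else_)
  import Data.Fin as Fin
  import Data.Fin.Properties as Finₚ
  open import Data.List using ([]; _∷_; foldr)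
  import Data.Nat as ℕ
  open import Data.Product using (_,_; proj₁; proj₂)
  open import Data.Product.Properties using (≡-dec)
  open import Data.Rational using (0ℚ; 1ℚ; _≤_; _-_)
  open import Data.Rational.Properties using (≤-trans; ≤-refl; 0≤∣p∣; +-identityˡ)
  open import Relation.Nullary using (Dec; yes; no; does)
  open import Relation.Nullary.Decidable using (_×-dec_)
  open import Relation.Binary.PropositionalEquality

  1≤d-closed-open : ∀ x y → Closed x → F y ≡ true → 1ℚ ≤ d pos x y
  1≤d-closed-open (j , v , ℓ) (j′ , v′ , ℓ′) x-closed y-open with ≡-dec Fin._≟_ Fin._≟_ (j , v) (j′ , v′)
  ... | yes refl rewrite proj₁ placement j v ℓ ℓ′ = 1≤∣ℕ→ℚ-ℕ→ℚ∣ ℓ≢ℓ′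
    where
    ℓ≢ℓ′ : Fin.toℕ ℓ ≢ Fin.toℕ ℓ′
    ℓ≢ℓ′ toℕ≡ with trans (sym x-closed) (trans (cong (λ ℓ → F (j , v , ℓ)) (Finₚ.toℕ-injective toℕ≡)) y-open)
    ... | ()
  ... | no  different = ≤-trans (ℕ→ℚ-mono-≤ {1} {2} (ℕ.s≤s ℕ.z≤n)) (proj₂ placement j v ℓ j′ v′ ℓ′ different)

  fin≤distF : ∀ x {c} → (∀ y → F y ≡ true → c ≤ d pos x y) → fin c ≤∞ distF pos x F
  fin≤distF x {c} c≤d = go allLocs
    where
    go : ∀ ys → fin c ≤∞ foldr (λ y acc → if F y then fin (d pos x y) ⊓∞ acc else acc) ∞ ys
    go []       = x≤∞
    go (y ∷ ys) with F y in y-open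
    ... | true  = ⊓∞-glb (fin≤fin (c≤d y y-open)) (go ys)
    ... | false = go ys

  clientCost≥unopened : ∀ e → fin (ℕ→ℚ (unopened e)) ≤∞ clientCost pos e F
  clientCost≥unopened e = go allLocs
    where
    go : ∀ xs → fin (ℕ→ℚ (count (λ x → e ∈X? x ×-dec closed? x) xs)) ≤∞
                foldr (λ x acc → if does (e ∈X? x) then distF pos x F +∞ acc else acc) (fin 0ℚ) xs
    go []       = fin≤fin ≤-refl
    go (x ∷ xs) = step x (e ∈X? x) (go xs)
      where
      step : ∀ x {acc c} (e∈x? : Dec (e ∈X x)) → fin (ℕ→ℚ c) ≤∞ acc →
             fin (ℕ→ℚ (𝟙 (e∈x? ×-dec closed? x) ℕ.+ c)) ≤∞ (if does e∈x? then distF pos x F +∞ acc else acc)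
      step x (no _)  c≤acc = c≤acc
      step x {c = c} (yes _) c≤acc with closed? x
      ... | yes x-closed rewrite ℕ→ℚ-+ 1 c =
        +∞-mono (fin≤distF x (λ y y-open → 1≤d-closed-open x y x-closed y-open)) c≤acc
      ... | no  _        = subst (λ q → fin q ≤∞ _) (+-identityˡ (ℕ→ℚ c))
                               (+∞-mono (fin≤distF x (λ y _ → 0≤∣p∣ (pos x - pos y))) c≤acc)

  objectiveAtLeast-unopened : ∀ {a} e → a ℕ.≤ unopened e → ObjectiveAtLeast pos (ℕ→ℚ a) F
  objectiveAtLeast-unopened e a≤ = e , ≤∞-trans (fin≤fin (ℕ→ℚ-mono-≤ a≤)) (clientCost≥unopened e)

module SatisfyingLabelings {r : ℕ} (G : HLC r) (m : ℕ) (ps : Fin (HLC.nE G) → PartitionSystem r (HLC.nC G) m)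
                           (F : Construction.Loc G m ps → Bool) (labels-nonempty : ∀ j → 0 Data.Nat.< HLC.nL G j) where

  open HLC G
  open Construction G m ps using (size; k)
  open FiniteSums
  open LabelCover G
  open ClosedLocations G m ps F
  open import Data.Bool using (if_then_else_)
  open import Data.Fin using (toℕ; fromℕ<)
  import Data.Fin as Fin
  import Data.Fin.Properties as Finₚ
  open import Data.List using (List; []; _∷_; filter; allFin; length; cartesianProduct)
  open import Data.List.Membership.Propositional using (_∈_)
  open import Data.List.Membership.Propositional.Properties using (∈-allFin; ∈-filter⁺; ∈-cartesianProduct⁺)
  open import Data.List.Relation.Unary.Any using (here; there)
  open import Data.Nat using (zero; suc; _*_; _^_; _≤_; _<_; _≤?_; z≤n; s≤s)
  import Data.Nat.Properties as ℕ
  open import Data.Product using (∃; _×_; _,_; proj₁; proj₂)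
  open import Function using (_∘_)
  open import Relation.Nullary using (Dec; yes; no; does)
  open import Relation.Nullary.Decidable using (dec-true; dec-false)
  open import Relation.Binary.PropositionalEquality

  lookupOr : {A : Set} → A → List A → ℕ → A
  lookupOr d []       _       = d
  lookupOr d (x ∷ xs) zero    = x
  lookupOr d (x ∷ xs) (suc n) = lookupOr d xs n

  ∈⇒lookupOr : {A : Set} {x : A} {xs : List A} (d : A) → x ∈ xs → ∃ λ n → n < length xs × lookupOr d xs n ≡ x
  ∈⇒lookupOr d (here refl) = zero , s≤s z≤n , refl
  ∈⇒lookupOr d (there x∈)  = let n , n< , lookup≡x = ∈⇒lookupOr d x∈ in suc n , s≤s n< , lookup≡x

  default : (j : Fin r) → Fin (nL j)
  default j = fromℕ< (labels-nonempty j)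

  closedLabels : (j : Fin r) → Fin (nV j) → List (Fin (nL j))
  closedLabels j v = filter (λ ℓ → closed? (j , v , ℓ)) (allFin (nL j))

  pick : (j : Fin r) → Fin (nV j) → Fin r → Fin (nL j)
  pick j v i = lookupOr (default j) (closedLabels j v) (toℕ i)

  pick-surjective : ∀ {j v ℓ} → #closed j v < r → Closed (j , v , ℓ) → ∃ λ i → pick j v i ≡ ℓ
  pick-surjective {j} {v} {ℓ} few ℓ-closed =
    fromℕ< n<r , trans (cong (lookupOr (default j) (closedLabels j v)) (Finₚ.toℕ-fromℕ< n<r)) lookup≡ℓ
    where
    found = ∈⇒lookupOr (default j) (∈-filter⁺ (λ ℓ → closed? (j , v , ℓ)) (∈-allFin ℓ) ℓ-closed)
    n = proj₁ found
    lookup≡ℓ = proj₂ (proj₂ found)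
    n<r : n < r
    n<r = ℕ.<-trans (subst (n <_) (length-filter≡count _ (allFin (nL j))) (proj₁ (proj₂ found))) few

  Choice : Set
  Choice = Fin r × Fin r × Fin r × Fin r

  choices : List Choice
  choices = cartesianProduct (allFin r) (cartesianProduct (allFin r) (cartesianProduct (allFin r) (allFin r)))

  ∈-choices : ∀ w → w ∈ choices
  ∈-choices (j₁ , j₂ , i₁ , i₂) =
    ∈-cartesianProduct⁺ (∈-allFin j₁)
      (∈-cartesianProduct⁺ (∈-allFin j₂) (∈-cartesianProduct⁺ (∈-allFin i₁) (∈-allFin i₂)))

  length-choices : length choices ≡ r ^ 4
  length-choices = begin
    length choices                  ≡⟨ length-cartesianProduct (allFin r) _ ⟩
    length (allFin r) * length (cartesianProduct (allFin r) (cartesianProduct (allFin r) (allFin r)))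
      ≡⟨ cong₂ _*_ (length-allFin r) (trans (length-cartesianProduct (allFin r) _)
           (cong₂ _*_ (length-allFin r) (trans (length-cartesianProduct (allFin r) (allFin r))
             (cong₂ _*_ (length-allFin r) (length-allFin r))))) ⟩
    r * (r * (r * r))               ≡⟨ cong (λ x → r * (r * (r * x))) (ℕ.*-identityʳ r) ⟨
    r ^ 4                           ∎
    where open ≡-Reasoning

  -- r⁴ labelings guessing the two parts of a clash and the positions of its labels among the
  -- closed labels of their vertices; one of them satisfies any edge with a clash.
  labeling : Choice → Labeling G
  labeling (j₁ , j₂ , i₁ , i₂) j v =
    if does (j Fin.≟ j₁) then pick j v i₁ else if does (j Fin.≟ j₂) then pick j v i₂ else default j

  clash⇒satisfied : ∀ h {a b} → Clash h a b → (∀ j → #closed j (edge h j) < r) → ∃ λ w → WeaklySatisfied G (labeling w) h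
  clash⇒satisfied h {j , ℓ} {j′ , ℓ′} (j≢j′ , ℓ-closed , ℓ′-closed , sameColour) few
    with pick-surjective (few j) ℓ-closed | pick-surjective (few j′) ℓ′-closed
  ... | i , pick≡ℓ | i′ , pick≡ℓ′ = w , j , j′ , j≢j′ , (begin
    π h j (labeling w j (edge h j))     ≡⟨ cong (π h j) labelⱼ ⟩
    π h j ℓ                             ≡⟨ sameColour ⟩
    π h j′ ℓ′                           ≡⟨ cong (π h j′) labelⱼ′ ⟨
    π h j′ (labeling w j′ (edge h j′))  ∎)
    where
    open ≡-Reasoning
    w = j , j′ , i , i′
    labelⱼ : labeling w j (edge h j) ≡ ℓ
    labelⱼ rewrite dec-true (j Fin.≟ j) refl = pick≡ℓ
    labelⱼ′ : labeling w j′ (edge h j′) ≡ ℓ′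
    labelⱼ′ rewrite dec-false (j′ Fin.≟ j) (j≢j′ ∘ sym) | dec-true (j′ Fin.≟ j′) refl = pick≡ℓ′

  #closedOnEdge≤r*r : (∀ h j → #closed j (edge h j) < r) → ∀ h → #closedOnEdge h ≤ r * r
  #closedOnEdge≤r*r few h = ℕ.≤-trans (∑-mono-≤ (allFin r) (λ j → ℕ.<⇒≤ (few h j))) (ℕ.≤-reflexive (∑-allFin-const r r))

  r*r*[r⁴*s]≡r⁶*s : ∀ s → r * r * (r ^ 4 * s) ≡ r ^ 6 * s
  r*r*[r⁴*s]≡r⁶*s s = begin
    r * r * (r ^ 4 * s)   ≡⟨ ℕ.*-assoc r r (r ^ 4 * s) ⟩
    r * (r * (r ^ 4 * s)) ≡⟨ cong (r *_) (ℕ.*-assoc r (r ^ 4) s) ⟨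
    r * (r ^ 5 * s)       ≡⟨ ℕ.*-assoc r (r ^ 5) s ⟨
    r ^ 6 * s             ∎
    where open ≡-Reasoning

  module _ (r≤nC : r ≤ nC) (fewUnopened : ∀ e → unopened e < r) where

    Crowded? : ∀ h → Dec (r ≤ #closedOnEdge h)
    Crowded? h = r ≤? #closedOnEdge h

    #crowded≤∑numSatisfied : count Crowded? (allFin nE) ≤ ∑[ w ∈ choices ] numSatisfied G (labeling w)
    #crowded≤∑numSatisfied = begin
      count Crowded? (allFin nE)                                                ≤⟨ ∑-mono-≤ (allFin nE) (λ h → crowded≤ h (Crowded? h)) ⟩
      ∑[ h ∈ allFin nE ] ∑[ w ∈ choices ] 𝟙 (weaklySatisfied? G (labeling w) h) ≡⟨ ∑-comm (allFin nE) choices _ ⟩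
      ∑[ w ∈ choices ] count (weaklySatisfied? G (labeling w)) (allFin nE)      ≡⟨ ∑-cong choices (numSatisfied≡count ∘ labeling) ⟨
      ∑[ w ∈ choices ] numSatisfied G (labeling w)                              ∎
      where
      open ℕ.≤-Reasoning
      crowded≤ : ∀ h (crowded? : Dec (r ≤ #closedOnEdge h)) → 𝟙 crowded? ≤ ∑[ w ∈ choices ] 𝟙 (weaklySatisfied? G (labeling w) h)
      crowded≤ h (no  _) = z≤n
      crowded≤ h (yes crowded) with ∃-clash r≤nC fewUnopened h crowded
      ... | _ , _ , clash with clash⇒satisfied h clash (#closed<r r≤nC fewUnopened h)
      ...   | w , satisfied = ℕ.≤-trans (ℕ.≤-reflexive (sym (𝟙-yes (weaklySatisfied? G (labeling w) h) satisfied)))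
                                        (∈⇒≤∑ choices _ (∈-choices w))

    ∃-choice-satisfying-nE/r⁶ : 1 ≤ r → Regular G → size F ≡ k → ∃ λ w → nE ≤ r ^ 6 * numSatisfied G (labeling w)
    ∃-choice-satisfying-nE/r⁶ 1≤r regular |F|≡k =
      let j₀ = fromℕ< 1≤r
          w , ∑≤ = ∃-∑≤length* (j₀ , j₀ , j₀ , j₀) choices (numSatisfied G ∘ labeling)
      in w , (begin
        nE                                                     ≡⟨ length-allFin nE ⟨
        length (allFin nE)                                     ≤⟨ reverseMarkov (allFin nE) #closedOnEdge 1≤r (#closedOnEdge≤r*r few) nE*r≤∑ ⟩
        r * r * count Crowded? (allFin nE)                     ≤⟨ ℕ.*-monoʳ-≤ (r * r) #crowded≤∑numSatisfied ⟩
        r * r * ∑[ w ∈ choices ] numSatisfied G (labeling w)   ≤⟨ ℕ.*-monoʳ-≤ (r * r) ∑≤ ⟩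
        r * r * (length choices * numSatisfied G (labeling w)) ≡⟨ cong (λ n → r * r * (n * numSatisfied G (labeling w))) length-choices ⟩
        r * r * (r ^ 4 * numSatisfied G (labeling w))          ≡⟨ r*r*[r⁴*s]≡r⁶*s (numSatisfied G (labeling w)) ⟩
        r ^ 6 * numSatisfied G (labeling w)                    ∎)
      where
      open ℕ.≤-Reasoning
      few : ∀ h j → #closed j (edge h j) < r
      few = #closed<r r≤nC fewUnopened
      nE*r≤∑ : length (allFin nE) * r ≤ ∑[ h ∈ allFin nE ] #closedOnEdge h
      nE*r≤∑ = ℕ.≤-reflexive (trans (cong (_* r) (length-allFin nE)) (sym (∑-#closedOnEdge≡nE*r labels-nonempty |F|≡k regular)))

  ∃-labeling-satisfying-nE/r⁶ : 1 ≤ r → Regular G → size F ≡ k → (∀ e → unopened e < r) →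
                                ∃ λ σ → nE ≤ r ^ 6 * numSatisfied G σ
  ∃-labeling-satisfying-nE/r⁶ 1≤r regular |F|≡k fewUnopened with r ≤? nC
  ... | yes r≤nC = let w , nE≤ = ∃-choice-satisfying-nE/r⁶ r≤nC fewUnopened 1≤r regular |F|≡k in labeling w , nE≤
  ... | no  r≰nC = σ , (begin
    nE                       ≡⟨ ℕ.*-identityˡ nE ⟨
    1 * nE                   ≤⟨ ℕ.*-monoˡ-≤ nE (ℕ.^-monoˡ-≤ 6 1≤r) ⟩
    r ^ 6 * nE               ≡⟨ cong (r ^ 6 *_) (allSatisfied⇒numSatisfied≡nE σ (fewColours⇒weaklySatisfied (ℕ.≰⇒> r≰nC) σ)) ⟨
    r ^ 6 * numSatisfied G σ ∎)
    where
    open ℕ.≤-Reasoning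
    σ : Labeling G
    σ j v = default j

open import Data.Nat using (ℕ; _^_)
open import Data.Fin using (Fin)
open import Data.Bool using (Bool)
open import Data.Product using (_×_)
open import Data.Rational using (ℚ; _*_; _<_; _≤_; 0ℚ; 1ℚ)
open import Relation.Binary.PropositionalEquality using (_≡_)
open import Data.Empty using (⊥-elim)
open import Data.Fin using (fromℕ<)
import Data.Fin.Properties as Finₚ
open import Data.Nat using (zero; suc; z≤n; s≤s; _≤?_)
import Data.Nat.Properties as ℕ
open import Data.Product using (∃; _,_; proj₁)
open import Data.Rational using (nonNegative)
open import Data.Rational.Properties using (≤-<-trans; *-monoʳ-≤-nonNeg; <⇒≤)
open import Relation.Nullary using (Dec; yes; no)
open NatInRational using (ℕ→ℚ-mono-≤; q*s<N)
open ClosedLocations using (unopened)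
open ClientCost using (objectiveAtLeast-unopened)
open SatisfyingLabelings using (∃-labeling-satisfying-nE/r⁶)

mainTheorem8 : (r : ℕ) (G : HLC r) →
    (∀ j → 0 Data.Nat.< HLC.nL G j) →
    0 Data.Nat.< HLC.nE G →
    Regular G →
    (ε : ℚ) → 0ℚ < ε → ℕ→ℚ (r ^ 7) * ε < 1ℚ →
    (∀ (σ : Labeling G) → ℕ→ℚ (numSatisfied G σ) ≤ ε * ℕ→ℚ (HLC.nE G)) →
    (m : ℕ) (ps : Fin (HLC.nE G) → PartitionSystem r (HLC.nC G) m) →
    (pos : Construction.Loc G m ps → ℚ) → Construction.LinePlacement G m ps pos →
    (F : Construction.Loc G m ps → Bool) → Construction.size G m ps F ≡ Construction.k G m ps →
    Construction.ObjectiveAtLeast G m ps pos (ℕ→ℚ r) F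
mainTheorem8 zero G _ 0<nE _ _ _ _ _ m ps pos placement F _ =
  objectiveAtLeast-unopened G m ps pos placement F (h₀ , z₀) z≤n
  where
  h₀ = fromℕ< 0<nE
  z₀ = proj₁ (PartitionSystem.cover (ps h₀) (λ ()) (λ {i} → ⊥-elim (Finₚ.¬Fin0 i)) (λ ()))
mainTheorem8 r@(suc _) G labels-nonempty 0<nE regular ε 0<ε r⁷ε<1 sound m ps pos placement F |F|≡k =
  objective≥r (Finₚ.any? λ h → Finₚ.any? λ z → r ≤? unopened G m ps F (h , z))
  where
  -- With r = suc _, every implicit ℕ below is given, and the last step uses let rather than with:
  -- otherwise unification tries to normalise ℕ→ℚ (suc _ ^ 6).
  r⁶ε<1 : ℕ→ℚ (r ^ 6) * ε < 1ℚ
  r⁶ε<1 = ≤-<-trans (*-monoʳ-≤-nonNeg ε {{nonNegative (<⇒≤ 0<ε)}}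
                       (ℕ→ℚ-mono-≤ {r ^ 6} {r ^ 7} (ℕ.^-monoʳ-≤ r (ℕ.n≤1+n 6)))) r⁷ε<1
  objective≥r : Dec (∃ λ h → ∃ λ z → r Data.Nat.≤ unopened G m ps F (h , z)) →
                Construction.ObjectiveAtLeast G m ps pos (ℕ→ℚ r) F
  objective≥r (yes (h , z , r≤)) = objectiveAtLeast-unopened G m ps pos placement F (h , z) r≤
  objective≥r (no ∄e) =
    let σ , nE≤r⁶s = ∃-labeling-satisfying-nE/r⁶ G m ps F labels-nonempty (s≤s z≤n) regular |F|≡k
                       (λ (h , z) → ℕ.≰⇒> (λ r≤ → ∄e (h , z , r≤)))
    in ⊥-elim (ℕ.<⇒≱ (q*s<N {r ^ 6} {numSatisfied G σ} 0<nE r⁶ε<1 (sound σ)) nE≤r⁶s)
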